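{- Let $G$ be an almost bunchy graph and let $\Phi_1,\Phi_2\in\hom_R(G,M(G))$. Then $S_{\Phi_1}=S_{\Phi_2}$. In particular, $\sim_{\Phi_1}\,=\,\sim_{\Phi_2}$.
   Context: All graphs are finite directed graphs with state set $V(G)$, edge set $E(G)$, source/target maps $s,t$; loops and parallel edges allowed; all graphs sink-free. $E_I(G)=s^{ -1}(I)$, $F(I)=t(E_I(G))$, $L(G)$ finite edge paths, $L_I(G)$ those starting at $I$. A homomorphism consists of maps on edges and ($\partial\Phi$) on states commuting with $s,t$. A right-resolver is a surjective homomorphism with $\Phi|_{E_I(G)}:E_I(G)\to E_{\partial\Phi(I)}(H)$ bijective for all $I$; $\hom_R(G,H)$ the set of these. $M(G)$ is the unique $\leq_R$-minimal graph admitting a right-resolver from $G$; all right-resolvers $G\to M(G)$ share the state map $\Sigma_G$. For $\Phi\in\hom_R(G,H)$, $I\in V(G)$, $u\in L_{\partial\Phi(I)}(H)$, $I\cdot u$ is the endpoint of the unique lift of $u$ starting at $I$; $S_\Phi$ is the set of maps of the form $I\mapsto I\cdot u$ (for fixed $u\in L(H)$, defined on $(\partial\Phi)^{ -1}(s(u))$). Stability: $I_1\sim_\Phi I_2$ iff $\partial\Phi(I_1)=\partial\Phi(I_2)=:I$ and for all $u\in L_I(H)$ there is $v\in L_{t(u)}(H)$ with $I_1\cdot uv=I_2\cdot uv$. $G$ is almost bunchy if for each $I,J\in V(M(G))$ there is at most one $I'\in\Sigma_G^{ -1}(I)$ with $|F(I')\cap\Sigma_G^{ -1}(J)|\geq 2$.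 -}

module Defs where

open import Data.Nat using (ℕ)
open import Data.Fin using (Fin)
open import Data.List using (List; []; _∷_; map; _++_)
open import Data.Product using (Σ; ∃; _×_; _,_)
open import Data.Unit using (⊤)
open import Relation.Nullary using (¬_)
open import Relation.Binary.PropositionalEquality using (_≡_)
open import Function.Bundles using (_⇔_)

record Graph : Set where
  field
    nV       : ℕ
    nE       : ℕ
    src      : Fin nE → Fin nV
    tgt      : Fin nE → Fin nV
    sinkFree : ∀ (I : Fin nV) → ∃ λ (e : Fin nE) → src e ≡ I

open Graph public

V : Graph → Set
V G = Fin (nV G)

E : Graph → Set
E G = Fin (nE G)

IsPath : (G : Graph) → V G → List (E G) → Set
IsPath G I []      = ⊤
IsPath G I (e ∷ w) = src G e ≡ I × IsPath G (tgt G e) w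

endState : (G : Graph) → V G → List (E G) → V G
endState G I []      = I
endState G I (e ∷ w) = endState G (tgt G e) w

record Hom (G H : Graph) : Set where
  field
    edgeMap  : E G → E H
    stateMap : V G → V H
    comm-src : ∀ e → src H (edgeMap e) ≡ stateMap (src G e)
    comm-tgt : ∀ e → tgt H (edgeMap e) ≡ stateMap (tgt G e)

open Hom public

record RightResolver (G H : Graph) : Set where
  field
    hom        : Hom G H
    surjEdges  : ∀ (f : E H) → ∃ λ (e : E G) → edgeMap hom e ≡ f
    surjStates : ∀ (J : V H) → ∃ λ (I : V G) → stateMap hom I ≡ J
    -- Φ restricted to E_I(G) is a bijection onto E_{∂Φ(I)}(H)
    -- (it maps into E_{∂Φ(I)}(H) by comm-src)
    locInj     : ∀ (e e′ : E G) → src G e ≡ src G e′ →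
                 edgeMap hom e ≡ edgeMap hom e′ → e ≡ e′
    locSurj    : ∀ (I : V G) (f : E H) → src H f ≡ stateMap hom I →
                 ∃ λ (e : E G) → src G e ≡ I × edgeMap hom e ≡ f

open RightResolver public

∂ : ∀ {G H} → RightResolver G H → V G → V H
∂ Φ = stateMap (hom Φ)

_≤R_ : Graph → Graph → Set
H ≤R G = RightResolver G H

record IsMinimalResolvent (G M : Graph) : Set₁ where
  field
    resolvent : M ≤R G
    minimal   : ∀ (K : Graph) → K ≤R G → K ≤R M → M ≤R K

-- Lifting paths:  Lifts Φ I w K  means  I · w = K, i.e. the (unique)
-- lift of the H-path w starting at I ends at K.

Lifts : ∀ {G H} → RightResolver G H → V G → List (E H) → V G → Set
Lifts {G} Φ I w K =
  Σ (List (E G)) λ p → IsPath G I p × map (edgeMap (hom Φ)) p ≡ w × endState G I p ≡ K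

-- The map  I ↦ I · w  on (∂Φ)⁻¹(J), for the path w starting at J in H,
-- given as its graph (a functional relation whose domain is (∂Φ)⁻¹(J)).
ActRel : ∀ {G H} → RightResolver G H → V H → List (E H) → V G → V G → Set
ActRel Φ J w I K = ∂ Φ I ≡ J × Lifts Φ I w K

SameRel : ∀ {A : Set} → (A → A → Set) → (A → A → Set) → Set
SameRel R R′ = ∀ x y → R x y ⇔ R′ x y

-- S_Φ ⊆ S_Ψ : every map I ↦ I ·Φ u (u ∈ L(H)) equals some map I ↦ I ·Ψ u′
S⊆ : ∀ {G H} → RightResolver G H → RightResolver G H → Set
S⊆ {G} {H} Φ Ψ =
  ∀ (J : V H) (w : List (E H)) → IsPath H J w →
  Σ (V H) λ J′ → Σ (List (E H)) λ w′ → IsPath H J′ w′ ×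
    SameRel (ActRel Φ J w) (ActRel Ψ J′ w′)

SEq : ∀ {G H} → RightResolver G H → RightResolver G H → Set
SEq Φ Ψ = S⊆ Φ Ψ × S⊆ Ψ Φ

Stable : ∀ {G H} → RightResolver G H → V G → V G → Set
Stable {G} {H} Φ I₁ I₂ =
  ∂ Φ I₁ ≡ ∂ Φ I₂ ×
  (∀ (u : List (E H)) → IsPath H (∂ Φ I₁) u →
     Σ (List (E H)) λ v → IsPath H (endState H (∂ Φ I₁) u) v ×
       Σ (V G) λ K → Lifts Φ I₁ (u ++ v) K × Lifts Φ I₂ (u ++ v) K)

TwoFollowersIn : (G M : Graph) → (V G → V M) → V G → V M → Set
TwoFollowersIn G M Σ′ I′ J =
  Σ (V G) λ K₁ → Σ (V G) λ K₂ → ¬ (K₁ ≡ K₂) ×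
    (∃ λ (e₁ : E G) → src G e₁ ≡ I′ × tgt G e₁ ≡ K₁) ×
    (∃ λ (e₂ : E G) → src G e₂ ≡ I′ × tgt G e₂ ≡ K₂) ×
    Σ′ K₁ ≡ J × Σ′ K₂ ≡ J

AlmostBunchyWrt : (G M : Graph) → (V G → V M) → Set
AlmostBunchyWrt G M Σ′ =
  ∀ (I J : V M) (I₁ I₂ : V G) →
    Σ′ I₁ ≡ I → TwoFollowersIn G M Σ′ I₁ J →
    Σ′ I₂ ≡ I → TwoFollowersIn G M Σ′ I₂ J →
    I₁ ≡ I₂

-- G is almost bunchy, with M = M(G) and Σ_G the (common) state map of
-- the right-resolvers G → M(G).
AlmostBunchy : (G M : Graph) → Set
AlmostBunchy G M = ∀ (Ψ : RightResolver G M) → AlmostBunchyWrt G M (∂ Ψ)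

-- Two right-resolvers Φ, Ψ : G → M have the same fibres: identifying ∂ Φ a with
-- ∂ Φ b whenever ∂ Ψ a = ∂ Ψ b yields a quotient K of M with right-resolvers
-- G → K and M → K, so minimality gives M ≤R K, which forces the identification
-- to be trivial, as K would otherwise have fewer states than M.  On a common
-- fibre, almost bunchiness lets each edge f be matched by an edge f′ such that,
-- from every state of the fibre, the Φ-lift of f and the Ψ-lift of f′ end at the
-- same state.  Hence every path u has a partner u′ with I ·Φ u = I ·Ψ u′ on the
-- fibre; this gives S_Φ ⊆ S_Ψ, and transferring synchronising words back and
-- forth transfers stability.

module Submission where

open import Defs
open import Data.Fin using (Fin; zero; suc; punchOut)
open import Data.Fin.Properties using (_≟_; any?; punchOut-injective; <⇒notInjective)
open import Data.List using (List; []; _∷_; _++_)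
open import Data.List.Properties using (∷-injective)
open import Data.Nat using (ℕ; zero; suc)
open import Data.Nat.Properties using (n<1+n)
open import Data.Product using (Σ; ∃; ∃₂; _×_; _,_; proj₁; proj₂)
open import Data.Unit using (tt)
open import Function using (_∘_; id; _on_; _⇔_; mk⇔; Injective; Equivalence)
import Function.Properties.Equivalence as ⇔
open import Algebra.Definitions using (IdempotentFun)
open import Level using (0ℓ)
open import Relation.Binary using (Rel; IsEquivalence)
import Relation.Binary.Construct.On as On
open import Relation.Binary.Construct.Closure.ReflexiveTransitive using (ε; _◅_)
open import Relation.Binary.Construct.Closure.Symmetric using (fwd; bwd)
open import Relation.Binary.Construct.Closure.Equivalence as EqClosure using (EqClosure)
open import Relation.Binary.PropositionalEquality
open import Relation.Nullary using (¬_; yes; no; contradiction)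
open import Relation.Nullary.Decidable using (_×-dec_; ¬?; decidable-stable)
open import Relation.Unary using (Pred; Decidable)

-- Decidable subsets of Fin n

injective-endo-hits : ∀ {n} {f : Fin n → Fin n} (x : Fin n) →
                      Injective _≡_ _≡_ f → ¬ (∀ y → x ≢ f y)
injective-endo-hits {suc n} {f} x f-injective x∉image =
  <⇒notInjective (n<1+n n) punched-injective
  where
  punched : Fin (suc n) → Fin n
  punched y = punchOut (x∉image y)
  punched-injective : Injective _≡_ _≡_ punched
  punched-injective eq = f-injective (punchOut-injective (x∉image _) (x∉image _) eq)

record Enumeration {n : ℕ} (P : Pred (Fin n) 0ℓ) : Set where
  field
    size          : ℕ
    index         : ∀ x → P x → Fin size
    element       : Fin size → Fin n
    element-P     : ∀ i → P (element i)
    element-index : ∀ x p → element (index x p) ≡ x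
    index-element : ∀ i p → index (element i) p ≡ i

  index-cong : ∀ {x y} (p : P x) (q : P y) → x ≡ y → index x p ≡ index y q
  index-cong {x} p q x≡y = sym (index-at (trans (element-index x p) x≡y) q)
    where
    index-at : ∀ {i y} → element i ≡ y → (q : P y) → index y q ≡ i
    index-at {i} refl = index-element i

  index-injective : ∀ {x y} (p : P x) (q : P y) → index x p ≡ index y q → x ≡ y
  index-injective {x} {y} p q eq =
    trans (sym (element-index x p)) (trans (cong element eq) (element-index y q))

  element-injective : Injective _≡_ _≡_ element
  element-injective {i} {j} eq = begin
    i                            ≡⟨ index-element i (element-P i) ⟨
    index (element i) (element-P i) ≡⟨ index-cong (element-P i) (element-P j) eq ⟩
    index (element j) (element-P j) ≡⟨ index-element j (element-P j) ⟩
    j                            ∎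
    where open ≡-Reasoning

  injection⇒all : Decidable P → (f : Fin n → Fin size) → Injective _≡_ _≡_ f → ∀ x → P x
  injection⇒all P? f f-injective x with P? x
  ... | yes Px = Px
  ... | no ¬Px = contradiction x∉image
                   (injective-endo-hits x (f-injective ∘ element-injective))
    where
    x∉image : ∀ y → x ≢ element (f y)
    x∉image y x≡ = ¬Px (subst P (sym x≡) (element-P (f y)))

open Enumeration

enumerate : ∀ {n} {P : Pred (Fin n) 0ℓ} → Decidable P → Enumeration P
enumerate {zero} P? = record
  { size = 0 ; index = λ () ; element = λ () ; element-P = λ ()
  ; element-index = λ () ; index-element = λ () }
enumerate {suc n} {P} P? with P? zero
... | yes P0 = with-zero
  where
  module E = Enumeration (enumerate (P? ∘ suc))
  with-zero : Enumeration P
  with-zero .size = suc E.size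
  with-zero .index zero    _ = zero
  with-zero .index (suc x) p = suc (E.index x p)
  with-zero .element zero    = zero
  with-zero .element (suc i) = suc (E.element i)
  with-zero .element-P zero    = P0
  with-zero .element-P (suc i) = E.element-P i
  with-zero .element-index zero    _ = refl
  with-zero .element-index (suc x) p = cong suc (E.element-index x p)
  with-zero .index-element zero    _ = refl
  with-zero .index-element (suc i) p = cong suc (E.index-element i p)
... | no ¬P0 = without-zero
  where
  module E = Enumeration (enumerate (P? ∘ suc))
  without-zero : Enumeration P
  without-zero .size = E.size
  without-zero .index zero    p = contradiction p ¬P0
  without-zero .index (suc x) p = E.index x p
  without-zero .element = suc ∘ E.element
  without-zero .element-P = E.element-P
  without-zero .element-index zero    p = contradiction p ¬P0
  without-zero .element-index (suc x) p = cong suc (E.element-index x p)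
  without-zero .index-element = E.index-element

-- Representatives of a generated equivalence

module _ {n : ℕ} where

  merge : (Fin n → Fin n) → Fin n → Fin n → Fin n → Fin n
  merge r x y z with r z ≟ r y
  ... | yes _ = r x
  ... | no  _ = r z

  module _ (r : Fin n → Fin n) (x y : Fin n) where

    merge-idempotent : IdempotentFun _≡_ r → IdempotentFun _≡_ (merge r x y)
    merge-idempotent r-idem z with r z ≟ r y
    ... | yes _ = merge-rx
      where
      merge-rx : merge r x y (r x) ≡ r x
      merge-rx with r (r x) ≟ r y
      ... | yes _ = refl
      ... | no  _ = r-idem x
    ... | no rz≢ry = merge-rz
      where
      merge-rz : merge r x y (r z) ≡ r z
      merge-rz with r (r z) ≟ r y
      ... | yes eq = contradiction (trans (sym (r-idem z)) eq) rz≢ry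
      ... | no  _  = r-idem z

    merge-preserves : ∀ {z w} → r z ≡ r w → merge r x y z ≡ merge r x y w
    merge-preserves {z} {w} eq with r z ≟ r y | r w ≟ r y
    ... | yes _ | yes _ = refl
    ... | yes p | no ¬q = contradiction (trans (sym eq) p) ¬q
    ... | no ¬p | yes q = contradiction (trans eq q) ¬p
    ... | no  _ | no  _ = eq

    merge-identifies : merge r x y x ≡ merge r x y y
    merge-identifies with r x ≟ r y | r y ≟ r y
    ... | _     | no ¬p = contradiction refl ¬p
    ... | yes _ | yes _ = refl
    ... | no  _ | yes _ = refl

    merge-related : ∀ {_∼_ : Rel (Fin n) 0ℓ} → IsEquivalence _∼_ → x ∼ y →
                    (∀ z → z ∼ r z) → ∀ z → z ∼ merge r x y z
    merge-related {_∼_} isEq x∼y related z with r z ≟ r y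
    ... | no  _  = related z
    ... | yes eq = ∼.trans (subst (z ∼_) eq (related z))
                     (∼.trans (∼.sym (related y)) (∼.trans (∼.sym x∼y) (related x)))
      where module ∼ = IsEquivalence isEq

  -- Union-find: a representative function for the equivalence generated by the
  -- pairs (u i , v i), obtained by merging the pairs one at a time.
  identify : ∀ {m} → (Fin m → Fin n) → (Fin m → Fin n) → Fin n → Fin n
  identify {zero}  u v = id
  identify {suc m} u v = merge (identify (u ∘ suc) (v ∘ suc)) (u zero) (v zero)

  identify-idempotent : ∀ {m} (u v : Fin m → Fin n) → IdempotentFun _≡_ (identify u v)
  identify-idempotent {zero}  u v z = refl
  identify-idempotent {suc m} u v   =
    merge-idempotent _ (u zero) (v zero) (identify-idempotent (u ∘ suc) (v ∘ suc))

  identify-identifies : ∀ {m} (u v : Fin m → Fin n) i → identify u v (u i) ≡ identify u v (v i)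
  identify-identifies u v zero    = merge-identifies (identify (u ∘ suc) (v ∘ suc)) (u zero) (v zero)
  identify-identifies u v (suc i) = merge-preserves (identify (u ∘ suc) (v ∘ suc)) (u zero) (v zero)
                                      (identify-identifies (u ∘ suc) (v ∘ suc) i)

  identify-related : ∀ {m} {_∼_ : Rel (Fin n) 0ℓ} → IsEquivalence _∼_ → (u v : Fin m → Fin n) →
                     (∀ i → u i ∼ v i) → ∀ z → z ∼ identify u v z
  identify-related {zero}  isEq u v u∼v _ = IsEquivalence.refl isEq
  identify-related {suc m} isEq u v u∼v   =
    merge-related _ (u zero) (v zero) isEq (u∼v zero)
      (identify-related isEq (u ∘ suc) (v ∘ suc) (u∼v ∘ suc))

-- Lifting along a right-resolver

module Lifting {G H : Graph} (Φ : RightResolver G H) where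

  φ : E G → E H
  φ = edgeMap (hom Φ)

  -- Off the fibre, i.e. when src f ≢ ∂ Φ I, the lift is an arbitrary edge out of I.
  lift : V G → E H → E G
  lift I f with src H f ≟ ∂ Φ I
  ... | yes f∈ = proj₁ (locSurj Φ I f f∈)
  ... | no  _  = proj₁ (sinkFree G I)

  module _ (I : V G) (f : E H) (f∈ : src H f ≡ ∂ Φ I) where

    lift-src : src G (lift I f) ≡ I
    lift-src with src H f ≟ ∂ Φ I
    ... | yes f∈′ = proj₁ (proj₂ (locSurj Φ I f f∈′))
    ... | no  f∉  = contradiction f∈ f∉

    lift-image : φ (lift I f) ≡ f
    lift-image with src H f ≟ ∂ Φ I
    ... | yes f∈′ = proj₂ (proj₂ (locSurj Φ I f f∈′))
    ... | no  f∉  = contradiction f∈ f∉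

    lift-tgt : ∂ Φ (tgt G (lift I f)) ≡ tgt H f
    lift-tgt = trans (sym (comm-tgt (hom Φ) (lift I f))) (cong (tgt H) lift-image)

  lift-φ : ∀ I e → src G e ≡ I → lift I (φ e) ≡ e
  lift-φ I e refl = locInj Φ _ _ (lift-src I (φ e) φe∈) (lift-image I (φ e) φe∈)
    where
    φe∈ = comm-src (hom Φ) e

  Lifts-[] : ∀ {I K} → Lifts Φ I [] K ⇔ I ≡ K
  Lifts-[] = mk⇔ to (λ I≡K → [] , tt , refl , I≡K)
    where
    to : ∀ {I K} → Lifts Φ I [] K → I ≡ K
    to ([] , _ , _ , I≡K) = I≡K

  Lifts-∷ : ∀ {I e w K} → src G e ≡ I → Lifts Φ (tgt G e) w K → Lifts Φ I (φ e ∷ w) K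
  Lifts-∷ {e = e} e∈ (p , p-path , p-image , p-end) =
    e ∷ p , (e∈ , p-path) , cong (φ e ∷_) p-image , p-end

  Lifts-lift : ∀ {I f w K} → src H f ≡ ∂ Φ I →
               Lifts Φ I (f ∷ w) K ⇔ Lifts Φ (tgt G (lift I f)) w K
  Lifts-lift {I} {f} {w} {K} f∈ = mk⇔ to from
    where
    to : Lifts Φ I (f ∷ w) K → Lifts Φ (tgt G (lift I f)) w K
    to (e ∷ p , (e∈ , p-path) , image , p-end) with ∷-injective image
    ... | refl , p-image rewrite lift-φ I e e∈ = p , p-path , p-image , p-end
    from : Lifts Φ (tgt G (lift I f)) w K → Lifts Φ I (f ∷ w) K
    from L = subst (λ g → Lifts Φ I (g ∷ w) K) (lift-image I f f∈) (Lifts-∷ (lift-src I f f∈) L)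

  Lifts-++ : ∀ {I X K} u {v} → Lifts Φ I u X → Lifts Φ X v K → Lifts Φ I (u ++ v) K
  Lifts-++ [] L₁ L₂ rewrite Equivalence.to Lifts-[] L₁ = L₂
  Lifts-++ (f ∷ u) (e ∷ p , (e∈ , p-path) , image , p-end) L₂ with ∷-injective image
  ... | refl , p-image = Lifts-∷ e∈ (Lifts-++ u (p , p-path , p-image , p-end) L₂)

  Lifts-++⁻ : ∀ {I K} u {v} → Lifts Φ I (u ++ v) K → ∃ λ X → Lifts Φ I u X × Lifts Φ X v K
  Lifts-++⁻ {I} [] L = I , Equivalence.from Lifts-[] refl , L
  Lifts-++⁻ (f ∷ u) (e ∷ p , (e∈ , p-path) , image , p-end) with ∷-injective image
  ... | refl , p-image with Lifts-++⁻ u (p , p-path , p-image , p-end)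
  ...   | X , L₁ , L₂ = X , Lifts-∷ e∈ L₁ , L₂

  Lifts-endState : ∀ {I K} w → Lifts Φ I w K → endState H (∂ Φ I) w ≡ ∂ Φ K
  Lifts-endState [] ([] , _ , _ , refl) = refl
  Lifts-endState (f ∷ w) (e ∷ p , (refl , p-path) , image , p-end) with ∷-injective image
  ... | refl , p-image =
    trans (cong (λ J → endState H J w) (comm-tgt (hom Φ) e))
          (Lifts-endState w (p , p-path , p-image , p-end))

compose : ∀ {G M K} → RightResolver G M → RightResolver M K → RightResolver G K
compose {G} {M} {K} Φ Ψ = record
  { hom = record
    { edgeMap  = ψ ∘ φ
    ; stateMap = ∂ Ψ ∘ ∂ Φ
    ; comm-src = λ e → trans (comm-src (hom Ψ) (φ e)) (cong (∂ Ψ) (comm-src (hom Φ) e))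
    ; comm-tgt = λ e → trans (comm-tgt (hom Ψ) (φ e)) (cong (∂ Ψ) (comm-tgt (hom Φ) e))
    }
  ; surjEdges = λ f →
      let g , g↦f = surjEdges Ψ f ; e , e↦g = surjEdges Φ g in e , trans (cong ψ e↦g) g↦f
  ; surjStates = λ J →
      let x , x↦J = surjStates Ψ J ; I , I↦x = surjStates Φ x in I , trans (cong (∂ Ψ) I↦x) x↦J
  ; locInj = λ e e′ same-src eq → locInj Φ e e′ same-src
      (locInj Ψ (φ e) (φ e′) (trans (comm-src (hom Φ) e)
        (trans (cong (∂ Φ) same-src) (sym (comm-src (hom Φ) e′)))) eq)
  ; locSurj = λ I f f∈ →
      let g , g∈ , g↦f = locSurj Ψ (∂ Φ I) f f∈
          e , e∈ , e↦g = locSurj Φ I g g∈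
      in e , e∈ , trans (cong ψ e↦g) g↦f
  }
  where
  φ = edgeMap (hom Φ)
  ψ = edgeMap (hom Ψ)

-- Quotients of a graph

record OutMatching (M : Graph) (_∼_ : Rel (V M) 0ℓ) (x y : V M) : Set where
  field
    forth      : E M → E M
    back       : E M → E M
    forth-src  : ∀ {f} → src M f ≡ x → src M (forth f) ≡ y
    back-src   : ∀ {f} → src M f ≡ y → src M (back f) ≡ x
    back-forth : ∀ {f} → src M f ≡ x → back (forth f) ≡ f
    forth-back : ∀ {f} → src M f ≡ y → forth (back f) ≡ f
    forth-tgt  : ∀ {f} → src M f ≡ x → tgt M f ∼ tgt M (forth f)

module _ {M : Graph} {_∼_ : Rel (V M) 0ℓ} (isEq : IsEquivalence _∼_) where

  private module ∼ = IsEquivalence isEq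
  open OutMatching

  OutMatching-refl : ∀ {x} → OutMatching M _∼_ x x
  OutMatching-refl = record
    { forth = λ f → f ; back = λ f → f ; forth-src = λ s → s ; back-src = λ s → s
    ; back-forth = λ _ → refl ; forth-back = λ _ → refl ; forth-tgt = λ _ → ∼.refl }

  OutMatching-sym : ∀ {x y} → OutMatching M _∼_ x y → OutMatching M _∼_ y x
  OutMatching-sym m = record
    { forth = back m ; back = forth m ; forth-src = back-src m ; back-src = forth-src m
    ; back-forth = forth-back m ; forth-back = back-forth m
    ; forth-tgt = λ {f} f∈ → ∼.sym (subst (λ g → tgt M (back m f) ∼ tgt M g)
                                     (forth-back m f∈) (forth-tgt m (back-src m f∈))) }

  OutMatching-trans : ∀ {x y z} → OutMatching M _∼_ x y → OutMatching M _∼_ y z →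
                      OutMatching M _∼_ x z
  OutMatching-trans m n = record
    { forth = forth n ∘ forth m
    ; back = back m ∘ back n
    ; forth-src = forth-src n ∘ forth-src m
    ; back-src = back-src m ∘ back-src n
    ; back-forth = λ f∈ → trans (cong (back m) (back-forth n (forth-src m f∈))) (back-forth m f∈)
    ; forth-back = λ f∈ → trans (cong (forth n) (forth-back m (back-src n f∈))) (forth-back n f∈)
    ; forth-tgt = λ f∈ → ∼.trans (forth-tgt m f∈) (forth-tgt n (forth-src m f∈))
    }

  OutMatching-along : ∀ {T : Rel (V M) 0ℓ} → (∀ {x y} → T x y → OutMatching M _∼_ x y) →
                      ∀ {x y} → EqClosure T x y → OutMatching M _∼_ x y
  OutMatching-along m ε             = OutMatching-refl
  OutMatching-along m (fwd t ◅ ts) = OutMatching-trans (m t) (OutMatching-along m ts)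
  OutMatching-along m (bwd t ◅ ts) = OutMatching-trans (OutMatching-sym (m t)) (OutMatching-along m ts)

-- The quotient of M by the kernel of an idempotent r: its states are the fixed
-- points of r, and the out-edges of a class are those of its fixed point.
module Quotient (M : Graph) (r : V M → V M) (r-idem : IdempotentFun _≡_ r)
                (matching : ∀ x → OutMatching M (_≡_ on r) x (r x)) where

  Fixed : V M → Set
  Fixed x = r x ≡ x

  module S = Enumeration (enumerate {P = Fixed} (λ x → r x ≟ x))
  module Ed = Enumeration (enumerate {P = Fixed ∘ src M} (λ e → r (src M e) ≟ src M e))

  quotient : Graph
  quotient = record
    { nV = S.size
    ; nE = Ed.size
    ; src = λ i → S.index (src M (Ed.element i)) (Ed.element-P i)
    ; tgt = λ i → S.index (r (tgt M (Ed.element i))) (r-idem _)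
    ; sinkFree = λ i →
        let e , e∈ = sinkFree M (S.element i)
            e-fixed = subst Fixed (sym e∈) (S.element-P i)
        in Ed.index e e-fixed ,
           trans (S.index-cong _ _ (trans (cong (src M) (Ed.element-index e e-fixed)) e∈))
                 (S.index-element i (S.element-P i))
    }

  open OutMatching

  τ : E M → E M
  τ e = forth (matching (src M e)) e

  τ-at : ∀ x {e} → src M e ≡ x → τ e ≡ forth (matching x) e
  τ-at _ refl = refl

  τ-src : ∀ e → src M (τ e) ≡ r (src M e)
  τ-src e = forth-src (matching (src M e)) refl

  τ-fixed : ∀ e → Fixed (src M (τ e))
  τ-fixed e = trans (cong r (τ-src e)) (trans (r-idem _) (sym (τ-src e)))

  class : V M → V quotient
  class x = S.index (r x) (r-idem x)

  projection : RightResolver M quotient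
  projection = record
    { hom = record
      { edgeMap  = λ e → Ed.index (τ e) (τ-fixed e)
      ; stateMap = class
      ; comm-src = λ e → S.index-cong _ _
          (trans (cong (src M) (Ed.element-index (τ e) (τ-fixed e))) (τ-src e))
      ; comm-tgt = λ e → S.index-cong _ _
          (trans (cong (r ∘ tgt M) (Ed.element-index (τ e) (τ-fixed e)))
                 (sym (forth-tgt (matching (src M e)) refl)))
      }
    ; surjEdges = λ f →
        let x , x↦ = class-surjective (src quotient f)
            e , _ , e↦f = lifting x f (sym x↦)
        in e , e↦f
    ; surjStates = class-surjective
    ; locInj = λ e e′ same-src eq →
        let x = src M e
            m = matching x
        in trans (sym (back-forth m refl))
             (trans (cong (back m) (trans (sym (τ-at x refl))
                      (trans (Ed.index-injective _ _ eq) (τ-at x (sym same-src)))))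
                    (back-forth m (sym same-src)))
    ; locSurj = lifting
    }
    where
    class-surjective : ∀ i → ∃ λ x → class x ≡ i
    class-surjective i =
      S.element i , trans (S.index-cong _ _ (S.element-P i)) (S.index-element i (S.element-P i))

    lifting : ∀ x f → src quotient f ≡ class x →
              ∃ λ e → src M e ≡ x × Ed.index (τ e) (τ-fixed e) ≡ f
    lifting x f f∈ =
      let m = matching x
          g∈ : src M (Ed.element f) ≡ r x
          g∈ = S.index-injective _ _ f∈
          e = back m (Ed.element f)
          e∈ = back-src m g∈
      in e , e∈ , trans (Ed.index-cong _ _ (trans (τ-at x e∈) (forth-back m g∈)))
                        (Ed.index-element f (Ed.element-P f))

-- Right-resolvers onto a minimal resolvent have the same fibres

module _ {G M : Graph} (Φ Ψ : RightResolver G M) where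

  private
    module LΦ = Lifting Φ
    module LΨ = Lifting Ψ

  Linked : Rel (V M) 0ℓ
  Linked x y = ∃₂ λ a b → ∂ Φ a ≡ x × ∂ Φ b ≡ y × ∂ Ψ a ≡ ∂ Ψ b

  -- The out-edges of ∂ Φ a and of ∂ Φ b both correspond, through those of a and
  -- of b in G, to the out-edges of ∂ Ψ a = ∂ Ψ b.
  swap : V G → V G → E M → E M
  swap a b f = LΦ.φ (LΨ.lift b (LΨ.φ (LΦ.lift a f)))

  module _ {a b : V G} (same : ∂ Ψ a ≡ ∂ Ψ b) {f : E M} (f∈ : src M f ≡ ∂ Φ a) where

    private
      e = LΦ.lift a f
      e∈ = LΦ.lift-src a f f∈
      g = LΨ.φ e
      g∈ : src M g ≡ ∂ Ψ b
      g∈ = trans (comm-src (hom Ψ) e) (trans (cong (∂ Ψ) e∈) same)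
      e′ = LΨ.lift b g
      e′∈ = LΨ.lift-src b g g∈

    swap-src : src M (swap a b f) ≡ ∂ Φ b
    swap-src = trans (comm-src (hom Φ) e′) (cong (∂ Φ) e′∈)

    swap-involutive : swap b a (swap a b f) ≡ f
    swap-involutive = begin
      LΦ.φ (LΨ.lift a (LΨ.φ (LΦ.lift b (LΦ.φ e′)))) ≡⟨ cong (LΦ.φ ∘ LΨ.lift a ∘ LΨ.φ) (LΦ.lift-φ b e′ e′∈) ⟩
      LΦ.φ (LΨ.lift a (LΨ.φ e′))                    ≡⟨ cong (LΦ.φ ∘ LΨ.lift a) (LΨ.lift-image b g g∈) ⟩
      LΦ.φ (LΨ.lift a (LΨ.φ e))                     ≡⟨ cong LΦ.φ (LΨ.lift-φ a e e∈) ⟩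
      LΦ.φ e                                        ≡⟨ LΦ.lift-image a f f∈ ⟩
      f                                             ∎
      where open ≡-Reasoning

    swap-tgt : Linked (tgt M f) (tgt M (swap a b f))
    swap-tgt = tgt G e , tgt G e′ , LΦ.lift-tgt a f f∈ , sym (comm-tgt (hom Φ) e′) ,
               trans (sym (comm-tgt (hom Ψ) e)) (sym (LΨ.lift-tgt b g g∈))

  linked-matching : (r : V M → V M) → (∀ {x y} → Linked x y → r x ≡ r y) →
                    ∀ {x y} → Linked x y → OutMatching M (_≡_ on r) x y
  linked-matching r r-linked (a , b , refl , refl , same) = record
    { forth      = swap a b
    ; back       = swap b a
    ; forth-src  = swap-src same
    ; back-src   = swap-src (sym same)
    ; back-forth = swap-involutive same
    ; forth-back = swap-involutive (sym same)
    ; forth-tgt  = r-linked ∘ swap-tgt same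
    }

∂≡⇒∂≡ : ∀ {G M} → IsMinimalResolvent G M → (Φ Ψ : RightResolver G M) →
        ∀ {a b} → ∂ Ψ a ≡ ∂ Ψ b → ∂ Φ a ≡ ∂ Φ b
∂≡⇒∂≡ {G} {M} minimal Φ Ψ {a} {b} same = begin
  ∂ Φ a     ≡⟨ r-fixed (∂ Φ a) ⟨
  r (∂ Φ a) ≡⟨ r-linked (a , b , refl , refl , same) ⟩
  r (∂ Φ b) ≡⟨ r-fixed (∂ Φ b) ⟩
  ∂ Φ b     ∎
  where
  open ≡-Reasoning

  section : V M → V G
  section J = proj₁ (surjStates Ψ J)

  u v : V G → V M
  u = ∂ Φ
  v = ∂ Φ ∘ section ∘ ∂ Ψ

  r : V M → V M
  r = identify u v

  r-linked : ∀ {x y} → Linked Φ Ψ x y → r x ≡ r y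
  r-linked (a , b , refl , refl , same) = begin
    r (u a)                     ≡⟨ identify-identifies u v a ⟩
    r (∂ Φ (section (∂ Ψ a)))   ≡⟨ cong (r ∘ ∂ Φ ∘ section) same ⟩
    r (∂ Φ (section (∂ Ψ b)))   ≡⟨ identify-identifies u v b ⟨
    r (u b)                     ∎

  generators-linked : ∀ a → EqClosure (Linked Φ Ψ) (u a) (v a)
  generators-linked a = fwd (a , section (∂ Ψ a) , refl , refl , sym (proj₂ (surjStates Ψ _))) ◅ ε

  matching : ∀ x → OutMatching M (_≡_ on r) x (r x)
  matching x = OutMatching-along (On.isEquivalence r isEquivalence)
    (linked-matching Φ Ψ r r-linked)
    (identify-related (EqClosure.isEquivalence (Linked Φ Ψ)) u v generators-linked x)

  open Quotient M r (identify-idempotent u v) matching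

  Θ : RightResolver quotient M
  Θ = IsMinimalResolvent.minimal minimal quotient (compose Φ projection) projection

  preimage : V M → V quotient
  preimage x = proj₁ (surjStates Θ x)

  preimage-injective : Injective _≡_ _≡_ preimage
  preimage-injective {x} {y} eq =
    trans (sym (proj₂ (surjStates Θ x))) (trans (cong (∂ Θ) eq) (proj₂ (surjStates Θ y)))

  r-fixed : ∀ x → r x ≡ x
  r-fixed = S.injection⇒all (λ x → r x ≟ x) preimage preimage-injective

-- Transferring paths between right-resolvers

module Transfer {G M : Graph} (minimal : IsMinimalResolvent G M) (Φ Ψ : RightResolver G M)
                (bunchy : AlmostBunchyWrt G M (∂ Φ)) where

  private
    module LΦ = Lifting Φ
    module LΨ = Lifting Ψ

  Φ⇒Ψ : ∀ {a b} → ∂ Φ a ≡ ∂ Φ b → ∂ Ψ a ≡ ∂ Ψ b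
  Φ⇒Ψ = ∂≡⇒∂≡ minimal Ψ Φ

  Ψ⇒Φ : ∀ {a b} → ∂ Ψ a ≡ ∂ Ψ b → ∂ Φ a ≡ ∂ Φ b
  Ψ⇒Φ = ∂≡⇒∂≡ minimal Φ Ψ

  module _ {I₀ : V G} {f : E M} (f∈ : src M f ≡ ∂ Φ I₀) where

    InFibre : V G → Set
    InFibre I = ∂ Φ I ≡ ∂ Φ I₀

    f∈-at : ∀ {I} → InFibre I → src M f ≡ ∂ Φ I
    f∈-at I∈ = trans f∈ (sym I∈)

    candidate : V G → E M
    candidate I⋆ = LΨ.φ (LΦ.lift I⋆ f)

    candidate∈ : ∀ {I⋆ I} → InFibre I⋆ → InFibre I → src M (candidate I⋆) ≡ ∂ Ψ I
    candidate∈ {I⋆} I⋆∈ I∈ =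
      trans (comm-src (hom Ψ) _)
            (trans (cong (∂ Ψ) (LΦ.lift-src I⋆ f (f∈-at I⋆∈))) (Φ⇒Ψ (trans I⋆∈ (sym I∈))))

    Agree : V G → V G → Set
    Agree I⋆ I = tgt G (LΦ.lift I f) ≡ tgt G (LΨ.lift I (candidate I⋆))

    agree-self : ∀ {I⋆} → InFibre I⋆ → Agree I⋆ I⋆
    agree-self {I⋆} I⋆∈ = cong (tgt G) (sym (LΨ.lift-φ I⋆ _ (LΦ.lift-src I⋆ f (f∈-at I⋆∈))))

    disagree⇒two-followers : ∀ {I⋆ I} → InFibre I⋆ → InFibre I → ¬ Agree I⋆ I →
                             TwoFollowersIn G M (∂ Φ) I (tgt M f)
    disagree⇒two-followers {I⋆} {I} I⋆∈ I∈ ¬agree =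
      _ , _ , ¬agree ,
      (LΦ.lift I f , LΦ.lift-src I f (f∈-at I∈) , refl) ,
      (LΨ.lift I g , LΨ.lift-src I g (candidate∈ I⋆∈ I∈) , refl) ,
      LΦ.lift-tgt I f (f∈-at I∈) ,
      trans (Ψ⇒Φ (trans (LΨ.lift-tgt I g (candidate∈ I⋆∈ I∈)) (comm-tgt (hom Ψ) _)))
            (LΦ.lift-tgt I⋆ f (f∈-at I⋆∈))
      where
      g = candidate I⋆

    Disagrees : V G → V G → Set
    Disagrees I⋆ I = InFibre I × ¬ Agree I⋆ I

    disagrees? : ∀ I⋆ → Decidable (Disagrees I⋆)
    disagrees? I⋆ I = (∂ Φ I ≟ ∂ Φ I₀) ×-dec ¬? (tgt G (LΦ.lift I f) ≟ tgt G (LΨ.lift I (candidate I⋆)))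

    agrees-everywhere : ∀ {I⋆} → ¬ ∃ (Disagrees I⋆) → ∀ I → InFibre I → Agree I⋆ I
    agrees-everywhere none I I∈ = decidable-stable (_ ≟ _) (λ ¬agree → none (I , I∈ , ¬agree))

    -- Every disagreement exhibits a state of the fibre with two followers over
    -- tgt f; by almost bunchiness there is at most one such state, and it agrees
    -- with itself.
    agreeing-candidate : ∃ λ I⋆ → InFibre I⋆ × (∀ I → InFibre I → Agree I⋆ I)
    agreeing-candidate with any? (disagrees? I₀)
    ... | no none₀ = I₀ , refl , agrees-everywhere none₀
    ... | yes (I₁ , I₁∈ , ¬agree₀₁) with any? (disagrees? I₁)
    ...   | no none₁ = I₁ , I₁∈ , agrees-everywhere none₁
    ...   | yes (I₂ , I₂∈ , ¬agree₁₂) =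
      contradiction (subst (Agree I₁) I₁≡I₂ (agree-self I₁∈)) ¬agree₁₂
      where
      I₁≡I₂ : I₁ ≡ I₂
      I₁≡I₂ = bunchy (∂ Φ I₀) (tgt M f) I₁ I₂
                I₁∈ (disagree⇒two-followers refl I₁∈ ¬agree₀₁)
                I₂∈ (disagree⇒two-followers I₁∈ I₂∈ ¬agree₁₂)

  transfer-edge : ∀ {I₀ f} → src M f ≡ ∂ Φ I₀ →
                  ∃ λ f′ → ∀ {I} → ∂ Φ I ≡ ∂ Φ I₀ →
                    src M f′ ≡ ∂ Ψ I × tgt G (LΦ.lift I f) ≡ tgt G (LΨ.lift I f′)
  transfer-edge f∈ =
    let I⋆ , I⋆∈ , agree = agreeing-candidate f∈
    in candidate f∈ I⋆ , λ {I} I∈ → candidate∈ f∈ I⋆∈ I∈ , agree I I∈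

  transfer-path : ∀ {I₀} w → IsPath M (∂ Φ I₀) w →
                  ∃ λ w′ → IsPath M (∂ Ψ I₀) w′ ×
                    (∀ {I K} → ∂ Φ I ≡ ∂ Φ I₀ → Lifts Φ I w K ⇔ Lifts Ψ I w′ K)
  transfer-path [] _ = [] , tt , λ _ → ⇔.trans LΦ.Lifts-[] (⇔.sym LΨ.Lifts-[])
  transfer-path {I₀} (f ∷ w) (f∈ , w-path)
    with f′ , edge ← transfer-edge f∈
    with w′ , w′-path , lifts ← transfer-path w (subst (λ J → IsPath M J w) (sym (LΦ.lift-tgt I₀ f f∈)) w-path)
    = f′ ∷ w′ , (proj₁ (edge refl) , f′-path) , lifts-∷
    where
    I₁ = tgt G (LΦ.lift I₀ f)
    I₁-image : ∂ Φ I₁ ≡ tgt M f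
    I₁-image = LΦ.lift-tgt I₀ f f∈

    f′-path : IsPath M (tgt M f′) w′
    f′-path = subst (λ J → IsPath M J w′)
                (trans (cong (∂ Ψ) (proj₂ (edge refl))) (LΨ.lift-tgt I₀ f′ (proj₁ (edge refl))))
                w′-path

    lifts-∷ : ∀ {I K} → ∂ Φ I ≡ ∂ Φ I₀ → Lifts Φ I (f ∷ w) K ⇔ Lifts Ψ I (f′ ∷ w′) K
    lifts-∷ {I} {K} I∈ =
      ⇔.trans (LΦ.Lifts-lift (f∈-at f∈ I∈))
        (⇔.trans (subst (λ X → Lifts Φ Y w K ⇔ Lifts Ψ X w′ K) (proj₂ (edge I∈)) (lifts Y∈))
          (⇔.sym (LΨ.Lifts-lift (proj₁ (edge I∈)))))
      where
      Y = tgt G (LΦ.lift I f)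
      Y∈ : ∂ Φ Y ≡ ∂ Φ I₁
      Y∈ = trans (LΦ.lift-tgt I f (f∈-at f∈ I∈)) (sym I₁-image)

  S⊆-transfer : S⊆ Φ Ψ
  S⊆-transfer J w w-path with surjStates Φ J
  ... | I₀ , refl with transfer-path w w-path
  ...   | w′ , w′-path , lifts = ∂ Ψ I₀ , w′ , w′-path , λ I K → mk⇔
          (λ (I∈ , L) → Φ⇒Ψ I∈ , Equivalence.to (lifts I∈) L)
          (λ (I∈ , L) → Ψ⇒Φ I∈ , Equivalence.from (lifts (Ψ⇒Φ I∈)) L)

-- Transfer u along Φ ⇝ Ψ, synchronise with Ψ, and transfer the synchronising
-- word back along Ψ ⇝ Φ from the two (Φ-equivalent) states reached.
stable-transfer : ∀ {G M} → IsMinimalResolvent G M → (Φ Ψ : RightResolver G M) →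
                  AlmostBunchyWrt G M (∂ Φ) → AlmostBunchyWrt G M (∂ Ψ) →
                  ∀ {I₁ I₂} → Stable Ψ I₁ I₂ → Stable Φ I₁ I₂
stable-transfer {G} {M} minimal Φ Ψ bunchyΦ bunchyΨ {I₁} {I₂} (sameΨ , synchroniseΨ) =
  sameΦ , synchroniseΦ
  where
  module ΦΨ = Transfer minimal Φ Ψ bunchyΦ
  module ΨΦ = Transfer minimal Ψ Φ bunchyΨ
  module LΦ = Lifting Φ
  module LΨ = Lifting Ψ

  sameΦ : ∂ Φ I₁ ≡ ∂ Φ I₂
  sameΦ = ΦΨ.Ψ⇒Φ sameΨ

  synchroniseΦ : ∀ u → IsPath M (∂ Φ I₁) u →
                 Σ (List (E M)) λ v → IsPath M (endState M (∂ Φ I₁) u) v ×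
                   Σ (V G) λ K → Lifts Φ I₁ (u ++ v) K × Lifts Φ I₂ (u ++ v) K
  synchroniseΦ u u-path
    with u′ , u′-path , lifts-u ← ΦΨ.transfer-path u u-path
    with v′ , v′-path , K , L₁ , L₂ ← synchroniseΨ u′ u′-path
    with X₁ , A₁ , B₁ ← LΨ.Lifts-++⁻ u′ L₁
    with X₂ , A₂ , B₂ ← LΨ.Lifts-++⁻ u′ L₂
    with v , v-path , lifts-v ← ΨΦ.transfer-path {X₁} v′
                                 (subst (λ J → IsPath M J v′) (LΨ.Lifts-endState u′ A₁) v′-path)
    = v , subst (λ J → IsPath M J v) (sym (LΦ.Lifts-endState u C₁)) v-path , K ,
      LΦ.Lifts-++ u C₁ (Equivalence.to (lifts-v refl) B₁) ,
      LΦ.Lifts-++ u C₂ (Equivalence.to (lifts-v (ΦΨ.Φ⇒Ψ (sym ∂X₁≡∂X₂))) B₂)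
    where
    C₁ : Lifts Φ I₁ u X₁
    C₁ = Equivalence.from (lifts-u refl) A₁
    C₂ : Lifts Φ I₂ u X₂
    C₂ = Equivalence.from (lifts-u (sym sameΦ)) A₂
    ∂X₁≡∂X₂ : ∂ Φ X₁ ≡ ∂ Φ X₂
    ∂X₁≡∂X₂ = begin
      ∂ Φ X₁                   ≡⟨ LΦ.Lifts-endState u C₁ ⟨
      endState M (∂ Φ I₁) u    ≡⟨ cong (λ J → endState M J u) sameΦ ⟩
      endState M (∂ Φ I₂) u    ≡⟨ LΦ.Lifts-endState u C₂ ⟩
      ∂ Φ X₂                   ∎
      where open ≡-Reasoning

proposition5p6 : (G M : Graph) → IsMinimalResolvent G M → AlmostBunchy G M →
    (Φ₁ Φ₂ : RightResolver G M) →
    SEq Φ₁ Φ₂ × (∀ (I₁ I₂ : V G) → Stable Φ₁ I₁ I₂ ⇔ Stable Φ₂ I₁ I₂)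
proposition5p6 G M minimal bunchy Φ₁ Φ₂ =
  (Transfer.S⊆-transfer minimal Φ₁ Φ₂ (bunchy Φ₁) , Transfer.S⊆-transfer minimal Φ₂ Φ₁ (bunchy Φ₂)) ,
  λ I₁ I₂ → mk⇔ (stable-transfer minimal Φ₂ Φ₁ (bunchy Φ₂) (bunchy Φ₁))
                (stable-transfer minimal Φ₁ Φ₂ (bunchy Φ₁) (bunchy Φ₂))
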